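{- Let $p\in\mathbb Z[x]$ be a nice polynomial of degree $4$ having $0$ as a root of multiplicity one. Then: (a) all roots of $p$ are even; (b) at least one nonzero root of $p$ is a multiple of $4$; (c) at most one of the three critical points of $p$ (counted with multiplicity) is odd.
   Context: A polynomial $p\in\mathbb Z[x]$ of degree $d\ge2$ is nice if $p$ and its derivative $p'$ both factor as products of linear factors over $\mathbb Z$, i.e. $p=c\prod_{i=1}^d(x-x_i)$ and $p'=c'\prod_{j=1}^{d-1}(x-x'_j)$ with all $c,c',x_i,x'_j\in\mathbb Z$; the critical points of $p$ are $x'_1,\dots,x'_{d-1}$. -}

module Defs where

open import Data.Nat using (ℕ)
import Data.Nat.Divisibility as ℕD
open import Data.Integer using (ℤ; +_; _+_; _*_; -_; ∣_∣; 0ℤ; 1ℤ)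
open import Data.Integer.Divisibility using (_∣_)
open import Data.List using (List; []; _∷_; map)
open import Data.Vec using (Vec; []; _∷_)
open import Relation.Nullary using (¬_; Dec; ¬?)

-- Polynomials in ℤ[x] as coefficient lists, lowest degree first:
-- a₀ ∷ a₁ ∷ … ∷ aₙ ∷ [] represents a₀ + a₁ x + … + aₙ xⁿ.
Poly : Set
Poly = List ℤ

infixl 6 _+ₚ_
_+ₚ_ : Poly → Poly → Poly
[]       +ₚ q        = q
(a ∷ p)  +ₚ []       = a ∷ p
(a ∷ p)  +ₚ (b ∷ q)  = (a + b) ∷ (p +ₚ q)

scale : ℤ → Poly → Poly
scale c p = map (c *_) p

infixl 7 _*ₚ_
_*ₚ_ : Poly → Poly → Poly
[]      *ₚ q = []
(a ∷ p) *ₚ q = scale a q +ₚ (0ℤ ∷ (p *ₚ q))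

linear : ℤ → Poly
linear a = (- a) ∷ 1ℤ ∷ []

prodLin : ∀ {n} → Vec ℤ n → Poly
prodLin []       = 1ℤ ∷ []
prodLin (a ∷ as) = linear a *ₚ prodLin as

derivAux : ℤ → Poly → Poly
derivAux k []      = []
derivAux k (b ∷ q) = (k * b) ∷ derivAux (k + 1ℤ) q

deriv : Poly → Poly
deriv []      = []
deriv (a ∷ p) = derivAux 1ℤ p

Odd : ℤ → Set
Odd x = ¬ ((+ 2) ∣ x)

odd? : (x : ℤ) → Dec (Odd x)
odd? x = ¬? (2 ℕD.∣? ∣ x ∣)

module Submission where

-- Write the roots as 0, x, y, z and the critical points as u, v, w.  Comparing the
-- coefficients of p′ = c′ (X - u) (X - v) (X - w) gives c′ = 4c and
--   3 (x + y + z) = 4 (u + v + w),  2 (xy + xz + yz) = 4 (uv + uw + vw),  xyz = 4 uvw.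
-- So x + y + z and xy + xz + yz are even, and a parity check shows that x, y, z are then
-- all even.  Halving, x/2 + y/2 + z/2 is even, so one of x/2, y/2, z/2 is even, which is
-- (b).  With even roots, xy + xz + yz ≡ 0 mod 4 and xyz ≡ 0 mod 8, so uv + uw + vw and uvw
-- are even, and a second parity check rules out two odd critical points.

open import Defs
open import Data.Nat using (ℕ; _≤_)
open import Data.Integer using (ℤ; +_; 0ℤ; _≟_)
open import Data.Integer.Divisibility using (_∣_)
open import Data.Vec using (Vec; count; lookup)
open import Data.Vec.Relation.Unary.All using (All)
open import Data.Fin using (Fin)
open import Data.Product using (_×_; ∃-syntax)
open import Relation.Binary.PropositionalEquality using (_≡_; _≢_)

open import Data.Nat as ℕ using (suc)
open import Data.Nat.Properties using (suc-injective)
open import Data.Integer using (_+_; _*_; -_; _-_; NonZero; ≢-nonZero)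
open import Data.Integer.Properties using (neg-injective; *-cancelˡ-≡)
open import Data.Integer.DivMod using (_%_; _/_; a≡a%n+[a/n]*n; n%d<d)
open import Data.Integer.Divisibility.Signed
  using (divides; ∣-refl; ∣-trans; ∣m∣n⇒∣m+n; ∣m⇒∣-m; ∣n⇒∣m*n; ∣m⇒∣m*n;
         *-monoˡ-∣; *-monoʳ-∣; *-cancelˡ-∣; *-cancelʳ-∣; _∣?_; ∣⇒∣ᵤ; ∣ᵤ⇒∣)
  renaming (_∣_ to _∣ₛ_)
open import Data.Integer.Tactic.RingSolver using (solve; solve-∀)
open import Data.Fin as Fin using (toℕ; fromℕ<; punchIn)
open import Data.Fin.Properties using (toℕ-fromℕ<; all?)
open import Data.List using (List; []; _∷_)
open import Data.List.Relation.Binary.Pointwise using (Pointwise-≡⇒≡; ≡⇒Pointwise-≡; []; _∷_)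
open import Data.Vec using ([]; _∷_; insertAt)
open import Data.Vec.Properties using (insertAt-punchIn)
open import Data.Vec.Relation.Unary.All as All using ([]; _∷_)
open import Data.Vec.Relation.Unary.All.Properties using (lookup⁺)
open import Data.Vec.Relation.Unary.Any as Any using (Any; here; there; any?)
open import Data.Vec.Relation.Unary.Any.Properties using (lookup-index)
open import Data.Vec.Relation.Binary.Pointwise.Inductive using (Pointwise; []; _∷_)
open import Data.Product using (∃; ∃₂; _,_; map₂)
open import Function using (_∘_; _⇔_; mk⇔)
open import Level using (Level)
open import Relation.Unary using (Pred; Decidable)
open import Relation.Nullary using (Dec; yes; no; ¬_)
open import Relation.Nullary.Decidable using (True; toWitness; does-⇔; _→-dec_)
open import Relation.Binary.PropositionalEquality
  using (refl; sym; trans; cong; cong₂; subst; module ≡-Reasoning)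

private
  variable
    a ℓ : Level
    A : Set a
    n : ℕ

module _ {P Q : Pred A ℓ} {R : A → A → Set ℓ} (resp : ∀ {x y} → R x y → Q y → P x) where

  All-resp-Pointwise : ∀ {xs ys : Vec A n} → Pointwise R xs ys → All Q ys → All P xs
  All-resp-Pointwise []         []         = []
  All-resp-Pointwise (r ∷ rs) (qy ∷ qys) = resp r qy ∷ All-resp-Pointwise rs qys

  Any-resp-Pointwise : ∀ {xs ys : Vec A n} → Pointwise R xs ys → Any Q ys → Any P xs
  Any-resp-Pointwise (r ∷ rs) (here qy)   = here (resp r qy)
  Any-resp-Pointwise (r ∷ rs) (there qys) = there (Any-resp-Pointwise rs qys)

count-resp-Pointwise : ∀ {P : Pred A ℓ} {R : A → A → Set ℓ} (P? : Decidable P) →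
  (∀ {x y} → R x y → P x ⇔ P y) →
  ∀ {xs ys : Vec A n} → Pointwise R xs ys → count P? xs ≡ count P? ys
count-resp-Pointwise P? resp [] = refl
count-resp-Pointwise P? resp {x ∷ xs} {y ∷ ys} (r ∷ rs)
  rewrite does-⇔ (resp r) (P? x) (P? y) | count-resp-Pointwise P? resp rs = refl

module _ {P : Pred A ℓ} (P? : Decidable P) where

  count≡0⇒All¬ : ∀ (xs : Vec A n) → count P? xs ≡ 0 → All (¬_ ∘ P) xs
  count≡0⇒All¬ []       _ = []
  count≡0⇒All¬ (x ∷ xs) none with P? x
  ... | no ¬px = ¬px ∷ count≡0⇒All¬ xs none

  count≡1⇒insertAt : ∀ (xs : Vec A (suc n)) → count P? xs ≡ 1 →
    ∃₂ λ i ys → All (¬_ ∘ P) ys × ∃ λ y → P y × xs ≡ insertAt ys i y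
  count≡1⇒insertAt (x ∷ xs) one with P? x
  ... | yes px = Fin.zero , xs , count≡0⇒All¬ xs (suc-injective one) , x , px , refl
  count≡1⇒insertAt (x ∷ [])     () | no ¬px
  count≡1⇒insertAt (x ∷ xs@(_ ∷ _)) one | no ¬px with count≡1⇒insertAt xs one
  ... | i , ys , ¬Pys , y , py , xs≡ = Fin.suc i , x ∷ ys , ¬px ∷ ¬Pys , y , py , cong (x ∷_) xs≡

All-insertAt : ∀ {P : Pred A ℓ} {x} {xs : Vec A n} → P x → All P xs → ∀ i → All P (insertAt xs i x)
All-insertAt px pxs         Fin.zero    = px ∷ pxs
All-insertAt px (py ∷ pxs) (Fin.suc i) = py ∷ All-insertAt px pxs i

All-Any⇒Any-× : ∀ {P Q : Pred A ℓ} {xs : Vec A n} → All P xs → Any Q xs → Any (λ x → P x × Q x) xs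
All-Any⇒Any-× (px ∷ _)   (here qx) = here (px , qx)
All-Any⇒Any-× (_  ∷ pxs) (there q) = there (All-Any⇒Any-× pxs q)

Any⇒∃-lookup-insertAt : ∀ {P : Pred A ℓ} {xs : Vec A n} → Any P xs → ∀ i y →
  ∃[ j ] P (lookup (insertAt xs i y) j)
Any⇒∃-lookup-insertAt {P = P} {xs} p i y =
  punchIn i (Any.index p) , subst P (sym (insertAt-punchIn xs i y (Any.index p))) (lookup-index p)

infix 4 _≡_mod_
record _≡_mod_ (x y m : ℤ) : Set where
  constructor divides-difference
  field m∣x-y : m ∣ₛ x - y

module _ {m : ℤ} where

  ≡-mod-sym : ∀ {x y} → x ≡ y mod m → y ≡ x mod m
  ≡-mod-sym {x} {y} (divides-difference m∣x-y) =
    divides-difference (subst (m ∣ₛ_) (-[x-y]≡y-x x y) (∣m⇒∣-m m∣x-y))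
    where
    -[x-y]≡y-x : ∀ x y → - (x - y) ≡ y - x
    -[x-y]≡y-x = solve-∀

  +-cong-mod : ∀ {x y u v} → x ≡ y mod m → u ≡ v mod m → x + u ≡ y + v mod m
  +-cong-mod {x} {y} {u} {v} (divides-difference m∣x-y) (divides-difference m∣u-v) =
    divides-difference (subst (m ∣ₛ_) (sym (regroup x y u v)) (∣m∣n⇒∣m+n m∣x-y m∣u-v))
    where
    regroup : ∀ x y u v → x + u - (y + v) ≡ (x - y) + (u - v)
    regroup = solve-∀

  *-cong-mod : ∀ {x y u v} → x ≡ y mod m → u ≡ v mod m → x * u ≡ y * v mod m
  *-cong-mod {x} {y} {u} {v} (divides-difference m∣x-y) (divides-difference m∣u-v) =
    divides-difference (subst (m ∣ₛ_) (sym (regroup x y u v))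
      (∣m∣n⇒∣m+n (∣n⇒∣m*n x m∣u-v) (∣m⇒∣m*n v m∣x-y)))
    where
    regroup : ∀ x y u v → x * u - y * v ≡ x * (u - v) + (x - y) * v
    regroup = solve-∀

  ∣-resp-≡-mod : ∀ {d x y} → d ∣ₛ m → x ≡ y mod m → d ∣ₛ y → d ∣ₛ x
  ∣-resp-≡-mod {d} {x} {y} d∣m (divides-difference m∣x-y) d∣y =
    subst (d ∣ₛ_) (y+[x-y]≡x x y) (∣m∣n⇒∣m+n d∣y (∣-trans d∣m m∣x-y))
    where
    y+[x-y]≡x : ∀ x y → y + (x - y) ≡ x
    y+[x-y]≡x = solve-∀

  ≡-mod-% : ∀ x .{{_ : NonZero m}} → x ≡ + (x % m) mod m
  ≡-mod-% x = divides-difference (divides (x / m)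
    (trans (cong (λ t → t - + (x % m)) (a≡a%n+[a/n]*n x m)) (r+s-r≡s (+ (x % m)) (x / m * m))))
    where
    r+s-r≡s : ∀ r s → r + s - r ≡ s
    r+s-r≡s = solve-∀

module _ {m x y z x′ y′ z′ : ℤ}
         (x≡x′ : x ≡ x′ mod m) (y≡y′ : y ≡ y′ mod m) (z≡z′ : z ≡ z′ mod m) where

  sum-cong-mod : x + y + z ≡ x′ + y′ + z′ mod m
  sum-cong-mod = +-cong-mod (+-cong-mod x≡x′ y≡y′) z≡z′

  pair-sum-cong-mod : x * y + x * z + y * z ≡ x′ * y′ + x′ * z′ + y′ * z′ mod m
  pair-sum-cong-mod =
    +-cong-mod (+-cong-mod (*-cong-mod x≡x′ y≡y′) (*-cong-mod x≡x′ z≡z′)) (*-cong-mod y≡y′ z≡z′)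

  product-cong-mod : x * y * z ≡ x′ * y′ * z′ mod m
  product-cong-mod = *-cong-mod (*-cong-mod x≡x′ y≡y′) z≡z′

⟦_⟧ : Fin 2 → ℤ
⟦ r ⟧ = + toℕ r

parity : ∀ x → ∃[ r ] x ≡ ⟦ r ⟧ mod + 2
parity x = fromℕ< r<2 , subst (λ k → x ≡ + k mod + 2) (sym (toℕ-fromℕ< r<2)) (≡-mod-% x)
  where r<2 = n%d<d x (+ 2)

even-resp : ∀ {x y} → x ≡ y mod + 2 → + 2 ∣ₛ y → + 2 ∣ₛ x
even-resp = ∣-resp-≡-mod ∣-refl

odd-resp : ∀ {x y} → x ≡ y mod + 2 → Odd x ⇔ Odd y
odd-resp x≡y = mk⇔ (λ x-odd 2∣y → x-odd (∣⇒∣ᵤ (even-resp x≡y (∣ᵤ⇒∣ 2∣y))))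
                   (λ y-odd 2∣x → y-odd (∣⇒∣ᵤ (even-resp (≡-mod-sym x≡y) (∣ᵤ⇒∣ 2∣x))))

ParityInvariant : (ℤ → ℤ → ℤ → Set) → Set
ParityInvariant P = ∀ {x y z x′ y′ z′} →
  x ≡ x′ mod + 2 → y ≡ y′ mod + 2 → z ≡ z′ mod + 2 → P x′ y′ z′ → P x y z

on-residues? : {P : ℤ → ℤ → ℤ → Set} → (∀ x y z → Dec (P x y z)) →
  Dec (∀ r s t → P ⟦ r ⟧ ⟦ s ⟧ ⟦ t ⟧)
on-residues? P? = all? λ r → all? λ s → all? λ t → P? ⟦ r ⟧ ⟦ s ⟧ ⟦ t ⟧

-- The implicit argument is solved by normalisation: it evaluates the decision procedure
-- on all eight triples of residues.
by-parity : {P : ℤ → ℤ → ℤ → Set} (P? : ∀ x y z → Dec (P x y z)) → ParityInvariant P →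
  {True (on-residues? P?)} → ∀ x y z → P x y z
by-parity P? invariant {holds} x y z with parity x | parity y | parity z
... | r , x≡r | s , y≡s | t , z≡t = invariant x≡r y≡s z≡t (toWitness holds r s t)

all-even : ∀ x y z → + 2 ∣ₛ x + y + z → + 2 ∣ₛ x * y + x * z + y * z →
  All (+ 2 ∣ₛ_) (x ∷ y ∷ z ∷ [])
all-even = by-parity
  (λ x y z → + 2 ∣? x + y + z →-dec + 2 ∣? x * y + x * z + y * z →-dec
               All.all? (+ 2 ∣?_) (x ∷ y ∷ z ∷ []))
  λ x≡ y≡ z≡ at-residues sum pairs →
    All-resp-Pointwise even-resp (x≡ ∷ y≡ ∷ z≡ ∷ [])
      (at-residues (even-resp (≡-mod-sym (sum-cong-mod x≡ y≡ z≡)) sum)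
                   (even-resp (≡-mod-sym (pair-sum-cong-mod x≡ y≡ z≡)) pairs))

some-even : ∀ x y z → + 2 ∣ₛ x + y + z → Any (+ 2 ∣ₛ_) (x ∷ y ∷ z ∷ [])
some-even = by-parity
  (λ x y z → + 2 ∣? x + y + z →-dec any? (+ 2 ∣?_) (x ∷ y ∷ z ∷ []))
  λ x≡ y≡ z≡ at-residues sum →
    Any-resp-Pointwise even-resp (x≡ ∷ y≡ ∷ z≡ ∷ [])
      (at-residues (even-resp (≡-mod-sym (sum-cong-mod x≡ y≡ z≡)) sum))

at-most-one-odd : ∀ x y z → + 2 ∣ₛ x * y + x * z + y * z → + 2 ∣ₛ x * y * z →
  count odd? (x ∷ y ∷ z ∷ []) ≤ 1
at-most-one-odd = by-parity
  (λ x y z → + 2 ∣? x * y + x * z + y * z →-dec + 2 ∣? x * y * z →-dec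
               count odd? (x ∷ y ∷ z ∷ []) ℕ.≤? 1)
  λ {x} {y} {z} {x′} {y′} {z′} x≡ y≡ z≡ at-residues pairs product →
    subst (_≤ 1) (sym (count-resp-Pointwise odd? odd-resp
                        {xs = x ∷ y ∷ z ∷ []} {x′ ∷ y′ ∷ z′ ∷ []} (x≡ ∷ y≡ ∷ z≡ ∷ [])))
      (at-residues (even-resp (≡-mod-sym (pair-sum-cong-mod x≡ y≡ z≡)) pairs)
                   (even-resp (≡-mod-sym (product-cong-mod x≡ y≡ z≡)) product))

deriv-quartic : ∀ c a b d f →
  deriv (scale c (prodLin (a ∷ b ∷ d ∷ f ∷ [])))
    ≡ - (c * (a * b * d + a * b * f + a * d * f + b * d * f))
    ∷ + 2 * c * (a * b + a * d + a * f + b * d + b * f + d * f)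
    ∷ - (+ 3 * c * (a + b + d + f))
    ∷ + 4 * c ∷ []
deriv-quartic c a b d f = Pointwise-≡⇒≡ (solve vs ∷ solve vs ∷ solve vs ∷ solve vs ∷ [])
  where vs : List ℤ
        vs = c ∷ a ∷ b ∷ d ∷ f ∷ []

scale-prodLin-cubic : ∀ c u v w →
  scale c (prodLin (u ∷ v ∷ w ∷ []))
    ≡ - (c * (u * v * w)) ∷ c * (u * v + u * w + v * w) ∷ - (c * (u + v + w)) ∷ c ∷ []
scale-prodLin-cubic c u v w = Pointwise-≡⇒≡ (solve vs ∷ solve vs ∷ solve vs ∷ solve vs ∷ [])
  where vs : List ℤ
        vs = c ∷ u ∷ v ∷ w ∷ []

coefficient-relations : ∀ {c c′ s₁ s₂ s₃ t₁ t₂ t₃} → c ≢ 0ℤ →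
  _≡_ {A = Poly} (- (c * s₃) ∷ + 2 * c * s₂ ∷ - (+ 3 * c * s₁) ∷ + 4 * c ∷ [])
                 (- (c′ * t₃) ∷ c′ * t₂ ∷ - (c′ * t₁) ∷ c′ ∷ []) →
  + 3 * s₁ ≡ + 4 * t₁ × + 2 * s₂ ≡ + 4 * t₂ × s₃ ≡ + 4 * t₃
coefficient-relations {c} c≢0 eq with ≡⇒Pointwise-≡ eq
... | e₀ ∷ e₁ ∷ e₂ ∷ refl ∷ [] =  -- the leading coefficients force c′ = 4c
  cancel-c (+ 3) (neg-injective e₂) , cancel-c (+ 2) e₁ ,
  *-cancelˡ-≡ c _ _ {{≢-nonZero c≢0}} (trans (neg-injective e₀) (sym (reassociate c (+ 4) _)))
  where
  reassociate : ∀ c k s → c * (k * s) ≡ k * c * s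
  reassociate = solve-∀
  cancel-c : ∀ k {s t} → k * c * s ≡ + 4 * c * t → k * s ≡ + 4 * t
  cancel-c k {s} {t} eq = *-cancelˡ-≡ c _ _ {{≢-nonZero c≢0}}
    (trans (reassociate c k s) (trans eq (sym (reassociate c (+ 4) t))))

critical-point-relations : ∀ {c c′} a b d f u v w → c ≢ 0ℤ →
  deriv (scale c (prodLin (a ∷ b ∷ d ∷ f ∷ []))) ≡ scale c′ (prodLin (u ∷ v ∷ w ∷ [])) →
  + 3 * (a + b + d + f) ≡ + 4 * (u + v + w) ×
  + 2 * (a * b + a * d + a * f + b * d + b * f + d * f) ≡ + 4 * (u * v + u * w + v * w) ×
  a * b * d + a * b * f + a * d * f + b * d * f ≡ + 4 * (u * v * w)
critical-point-relations {c} {c′} a b d f u v w c≢0 p′≡ = coefficient-relations c≢0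
  (trans (sym (deriv-quartic c a b d f)) (trans p′≡ (scale-prodLin-cubic c′ u v w)))

symmetric-functions-insert-0 : ∀ a b d f x y z i →
  a ∷ b ∷ d ∷ f ∷ [] ≡ insertAt (x ∷ y ∷ z ∷ []) i 0ℤ →
  a + b + d + f ≡ x + y + z ×
  a * b + a * d + a * f + b * d + b * f + d * f ≡ x * y + x * z + y * z ×
  a * b * d + a * b * f + a * d * f + b * d * f ≡ x * y * z
symmetric-functions-insert-0 _ _ _ _ x y z Fin.zero refl = solve vs , solve vs , solve vs
  where vs : List ℤ
        vs = x ∷ y ∷ z ∷ []
symmetric-functions-insert-0 _ _ _ _ x y z (Fin.suc Fin.zero) refl = solve vs , solve vs , solve vs
  where vs : List ℤ
        vs = x ∷ y ∷ z ∷ []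
symmetric-functions-insert-0 _ _ _ _ x y z (Fin.suc (Fin.suc Fin.zero)) refl = solve vs , solve vs , solve vs
  where vs : List ℤ
        vs = x ∷ y ∷ z ∷ []
symmetric-functions-insert-0 _ _ _ _ x y z (Fin.suc (Fin.suc (Fin.suc Fin.zero))) refl = solve vs , solve vs , solve vs
  where vs : List ℤ
        vs = x ∷ y ∷ z ∷ []

relations-with-root-0 : ∀ {c c′} a b d f x y z u v w i →
  a ∷ b ∷ d ∷ f ∷ [] ≡ insertAt (x ∷ y ∷ z ∷ []) i 0ℤ → c ≢ 0ℤ →
  deriv (scale c (prodLin (a ∷ b ∷ d ∷ f ∷ []))) ≡ scale c′ (prodLin (u ∷ v ∷ w ∷ [])) →
  + 3 * (x + y + z) ≡ + 4 * (u + v + w) ×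
  + 2 * (x * y + x * z + y * z) ≡ + 4 * (u * v + u * w + v * w) ×
  x * y * z ≡ + 4 * (u * v * w)
relations-with-root-0 {c} {c′} a b d f x y z u v w i roots≡ c≢0 p′≡ =
  let h₁ , h₂ , h₃ = critical-point-relations {c} {c′} a b d f u v w c≢0 p′≡
      s₁ , s₂ , s₃ = symmetric-functions-insert-0 a b d f x y z i roots≡
  in trans (cong (+ 3 *_) (sym s₁)) h₁ , trans (cong (+ 2 *_) (sym s₂)) h₂ , trans (sym s₃) h₃

4∣-of-3*≡4* : ∀ {s t} → + 3 * s ≡ + 4 * t → + 4 ∣ₛ s
4∣-of-3*≡4* {s} {t} eq = divides (s - t) (begin
  s                  ≡⟨ solve vs ⟩
  + 4 * s - + 3 * s  ≡⟨ cong (_-_ (+ 4 * s)) eq ⟩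
  + 4 * s - + 4 * t  ≡⟨ solve vs ⟩
  (s - t) * + 4      ∎)
  where
  open ≡-Reasoning
  vs : List ℤ
  vs = s ∷ t ∷ []

2∣-of-2*≡4* : ∀ {s t} → + 2 * s ≡ + 4 * t → + 2 ∣ₛ s
2∣-of-2*≡4* {s} {t} eq = divides t (*-cancelˡ-≡ (+ 2) s (t * + 2) (trans eq (4t≡2[2t] t)))
  where
  4t≡2[2t] : ∀ t → + 4 * t ≡ + 2 * (t * + 2)
  4t≡2[2t] = solve-∀

*-pres-∣ₛ : ∀ {a b x y} → a ∣ₛ x → b ∣ₛ y → a * b ∣ₛ x * y
*-pres-∣ₛ {a} {b} {x} {y} a∣x b∣y = ∣-trans (*-monoˡ-∣ b a∣x) (*-monoʳ-∣ x b∣y)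

module _ {x y z : ℤ} (evens : All (+ 2 ∣ₛ_) (x ∷ y ∷ z ∷ [])) where

  private
    2∣x = lookup⁺ evens Fin.zero
    2∣y = lookup⁺ evens (Fin.suc Fin.zero)
    2∣z = lookup⁺ evens (Fin.suc (Fin.suc Fin.zero))

  4∣pair-sum : + 4 ∣ₛ x * y + x * z + y * z
  4∣pair-sum = ∣m∣n⇒∣m+n (∣m∣n⇒∣m+n (*-pres-∣ₛ 2∣x 2∣y) (*-pres-∣ₛ 2∣x 2∣z)) (*-pres-∣ₛ 2∣y 2∣z)

  8∣product : + 8 ∣ₛ x * y * z
  8∣product = *-pres-∣ₛ (*-pres-∣ₛ 2∣x 2∣y) 2∣z

  some-root-divisible-by-4 : + 4 ∣ₛ x + y + z → Any (+ 4 ∣ₛ_) (x ∷ y ∷ z ∷ [])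
  some-root-divisible-by-4 4∣sum with 2∣x | 2∣y | 2∣z
  ... | divides x′ x≡ | divides y′ y≡ | divides z′ z≡ =
    Any-resp-Pointwise double-of-even (x≡ ∷ y≡ ∷ z≡ ∷ []) (some-even x′ y′ z′ half-sum-even)
    where
    double-of-even : ∀ {u u′} → u ≡ u′ * + 2 → + 2 ∣ₛ u′ → + 4 ∣ₛ u
    double-of-even u≡ 2∣u′ = subst (+ 4 ∣ₛ_) (sym u≡) (*-monoˡ-∣ (+ 2) 2∣u′)
    sum≡ : x + y + z ≡ (x′ + y′ + z′) * + 2
    sum≡ = trans (cong₂ _+_ (cong₂ _+_ x≡ y≡) z≡) (distrib x′ y′ z′)
      where
      distrib : ∀ x′ y′ z′ → x′ * + 2 + y′ * + 2 + z′ * + 2 ≡ (x′ + y′ + z′) * + 2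
      distrib = solve-∀
    half-sum-even : + 2 ∣ₛ x′ + y′ + z′
    half-sum-even = *-cancelʳ-∣ (+ 2) (subst (+ 4 ∣ₛ_) sum≡ 4∣sum)

relations⇒divisibility : ∀ x y z σ₁ σ₂ σ₃ →
  + 3 * (x + y + z) ≡ + 4 * σ₁ →
  + 2 * (x * y + x * z + y * z) ≡ + 4 * σ₂ →
  x * y * z ≡ + 4 * σ₃ →
  All (+ 2 ∣ₛ_) (x ∷ y ∷ z ∷ []) × Any (+ 4 ∣ₛ_) (x ∷ y ∷ z ∷ []) × + 2 ∣ₛ σ₂ × + 2 ∣ₛ σ₃
relations⇒divisibility x y z σ₁ σ₂ σ₃ h₁ h₂ h₃ =
  evens ,
  some-root-divisible-by-4 evens 4∣sum ,
  *-cancelˡ-∣ (+ 4) (subst (+ 8 ∣ₛ_) h₂ (*-monoʳ-∣ (+ 2) (4∣pair-sum evens))) ,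
  *-cancelˡ-∣ (+ 4) (subst (+ 8 ∣ₛ_) h₃ (8∣product evens))
  where
  4∣sum = 4∣-of-3*≡4* h₁
  evens = all-even x y z (∣-trans (divides (+ 2) refl) 4∣sum) (2∣-of-2*≡4* h₂)

corollary6p4 : (p : Poly) (c c′ : ℤ) (roots : Vec ℤ 4) (crit : Vec ℤ 3) →
    c ≢ 0ℤ →
    p ≡ scale c (prodLin roots) →
    deriv p ≡ scale c′ (prodLin crit) →
    count (_≟ 0ℤ) roots ≡ 1 →
    All (λ r → (+ 2) ∣ r) roots
      × (∃[ i ] (lookup roots i ≢ 0ℤ × (+ 4) ∣ lookup roots i))
      × count odd? crit ≤ 1
corollary6p4 p c c′ roots@(a ∷ b ∷ d ∷ f ∷ []) (u ∷ v ∷ w ∷ []) c≢0 refl p′≡ one-zero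
  with count≡1⇒insertAt (_≟ 0ℤ) roots one-zero
... | i , x ∷ y ∷ z ∷ [] , nonzero , _ , refl , roots≡ =
  let h₁ , h₂ , h₃ = relations-with-root-0 {c} {c′} a b d f x y z u v w i roots≡ c≢0 p′≡
      evens , some-4∣ , 2∣σ₂ , 2∣σ₃ = relations⇒divisibility x y z _ _ _ h₁ h₂ h₃
  in subst (All (λ r → + 2 ∣ r)) (sym roots≡)
       (All-insertAt (∣⇒∣ᵤ {+ 2} (divides 0ℤ refl)) (All.map ∣⇒∣ᵤ evens) i) ,
     subst (λ roots → ∃[ j ] (lookup roots j ≢ 0ℤ × + 4 ∣ lookup roots j)) (sym roots≡)
       (Any⇒∃-lookup-insertAt (Any.map (map₂ ∣⇒∣ᵤ) (All-Any⇒Any-× nonzero some-4∣)) i 0ℤ) ,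
     at-most-one-odd u v w 2∣σ₂ 2∣σ₃
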